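{- Let $V$ be a $\mathbb Q$-vector space with a right action of $G=\mathrm{GL}_2^+(\mathbb Q)$, let $Z\in\mathcal P(\mathbb Q)$ and $S=\mathrm{Stab}_G(Z)$. Then the sequence $$0\to V^{G}\to V^{S}\to \mathrm{Hom}_{G}(\Xi_0,V)\xrightarrow{U_Z} H^1(G,V)\xrightarrow{\mathrm{res}} H^1(S,V)$$ is exact, where $V^G\to V^S$ is the inclusion, $V^S\to\mathrm{Hom}_G(\Xi_0,V)$ sends $v$ to the homomorphism $[Z,\gamma^{ -1}Z]\mapsto v|(\gamma-1)$, $U_Z(\psi)$ is the class of the cocycle $\gamma\mapsto\psi([Z,\gamma^{ -1}Z])$, and $\mathrm{res}$ is restriction.
   Context: $\mathcal P(\mathbb Q)$ is the set of formal symbols $\pi_r(s)$, $r\ne s\in\mathbb P^1(\mathbb Q)$, with $\gamma\pi_r(s)=\pi_{\gamma r}(\gamma s)$; $\Xi_0$ is the group of degree-zero divisors on $\mathcal P(\mathbb Q)$, $[c_1,c_2]=\{c_2\}-\{c_1\}$. $\mathrm{Hom}_G(\Xi_0,V)$: homomorphisms with $\psi(\gamma\delta)=\psi(\delta)|\gamma^{ -1}$. Cocycles: $c(\gamma_1\gamma_2)=c(\gamma_1)|\gamma_2+c(\gamma_2)$; coboundaries $\gamma\mapsto v|(\gamma-1)$. $V^H$ denotes $H$-invariants. -}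

module Defs where

open import Level using (Level; _⊔_; suc)
open import Data.Empty using (⊥; ⊥-elim; ⊥-elim-irr)
open import Data.Product using (Σ; _×_; _,_; proj₁; proj₂)
open import Data.Maybe using (Maybe; just; nothing)
import Data.Maybe.Properties as MaybeP
open import Data.List using (List; []; _∷_; _++_; map)
open import Data.Integer as ℤ using (ℤ)
import Data.Integer.Properties as ℤP
open import Data.Rational
  using (ℚ; 0ℚ; 1ℚ; _+_; _*_; _-_; -_; 1/_; Positive; NonZero; ≢-nonZero)
open import Data.Rational.Properties
  using (_≟_; +-*-commutativeRing; *-inverseʳ; *-inverseˡ; pos⇒nonZero;
         1/pos⇒pos; pos*pos⇒pos; positive⁻¹; <-irrefl; *-identityˡ; *-identityʳ;
         *-assoc; *-comm; *-zeroʳ; *-zeroˡ; +-identityˡ; +-identityʳ; +-inverseʳ)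
open import Data.Rational.Solver using (module +-*-Solver)
open import Algebra.Module.Bundles using (Module)
open import Relation.Nullary using (yes; no; ¬_)
open import Relation.Binary.PropositionalEquality
  using (_≡_; _≢_; refl; sym; trans; cong; cong₂; subst; module ≡-Reasoning)

-- The group G = GL₂⁺(ℚ): 2×2 rational matrices (a b ; c d) with
-- positive determinant.  The positivity proof is irrelevant, so two
-- elements are equal iff their entries are equal.

det : ℚ → ℚ → ℚ → ℚ → ℚ
det a b c d = a * d - b * c

record GL2+ : Set where
  constructor mat
  field
    a b c d : ℚ
    .pos : Positive (det a b c d)

open GL2+ public

abstract
  det-∙-pos : ∀ a₁ b₁ c₁ d₁ a₂ b₂ c₂ d₂ →
    Positive (det a₁ b₁ c₁ d₁) → Positive (det a₂ b₂ c₂ d₂) →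
    Positive (det (a₁ * a₂ + b₁ * c₂) (a₁ * b₂ + b₁ * d₂)
                  (c₁ * a₂ + d₁ * c₂) (c₁ * b₂ + d₁ * d₂))
  det-∙-pos a₁ b₁ c₁ d₁ a₂ b₂ c₂ d₂ p₁ p₂ =
    subst Positive (sym eq) (pos*pos⇒pos (det a₁ b₁ c₁ d₁) {{p₁}} (det a₂ b₂ c₂ d₂) {{p₂}})
    where
    open +-*-Solver
    eq : det (a₁ * a₂ + b₁ * c₂) (a₁ * b₂ + b₁ * d₂) (c₁ * a₂ + d₁ * c₂) (c₁ * b₂ + d₁ * d₂)
         ≡ det a₁ b₁ c₁ d₁ * det a₂ b₂ c₂ d₂
    eq = solve 8 (λ a₁ b₁ c₁ d₁ a₂ b₂ c₂ d₂ →
           (a₁ :* a₂ :+ b₁ :* c₂) :* (c₁ :* b₂ :+ d₁ :* d₂)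
             :- (a₁ :* b₂ :+ b₁ :* d₂) :* (c₁ :* a₂ :+ d₁ :* c₂)
           := (a₁ :* d₁ :- b₁ :* c₁) :* (a₂ :* d₂ :- b₂ :* c₂))
           refl a₁ b₁ c₁ d₁ a₂ b₂ c₂ d₂

infixl 7 _∙_
_∙_ : GL2+ → GL2+ → GL2+
mat a₁ b₁ c₁ d₁ p₁ ∙ mat a₂ b₂ c₂ d₂ p₂ =
  mat (a₁ * a₂ + b₁ * c₂) (a₁ * b₂ + b₁ * d₂)
      (c₁ * a₂ + d₁ * c₂) (c₁ * b₂ + d₁ * d₂)
      (det-∙-pos a₁ b₁ c₁ d₁ a₂ b₂ c₂ d₂ p₁ p₂)

𝟙 : GL2+
𝟙 = mat 1ℚ 0ℚ 0ℚ 1ℚ _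

abstract
  det-⁻¹-pos : ∀ a b c d (p : Positive (det a b c d)) →
    let i = (1/ det a b c d) {{pos⇒nonZero (det a b c d) {{p}}}} in
    Positive (det (d * i) (- b * i) (- c * i) (a * i))
  det-⁻¹-pos a b c d p = subst Positive (sym eq) (1/pos⇒pos Δ {{p}})
    where
    Δ : ℚ
    Δ = det a b c d
    i : ℚ
    i = (1/ Δ) {{pos⇒nonZero Δ {{p}}}}
    open +-*-Solver
    eq : det (d * i) (- b * i) (- c * i) (a * i) ≡ i
    eq = begin
        det (d * i) (- b * i) (- c * i) (a * i)
      ≡⟨ solve 5 (λ a b c d i →
            (d :* i) :* (a :* i) :- (:- b :* i) :* (:- c :* i)
            := ((a :* d :- b :* c) :* i) :* i) refl a b c d i ⟩
        (Δ * i) * i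
      ≡⟨ cong (_* i) (*-inverseʳ Δ {{pos⇒nonZero Δ {{p}}}}) ⟩
        1ℚ * i
      ≡⟨ *-identityˡ i ⟩
        i ∎
      where open ≡-Reasoning

infix 8 _⁻¹
_⁻¹ : GL2+ → GL2+
mat a b c d p ⁻¹ = mat (d * i) (- b * i) (- c * i) (a * i) (det-⁻¹-pos a b c d p)
  where
  i = (1/ det a b c d) {{pos⇒nonZero (det a b c d) {{p}}}}

ℙ¹ : Set
ℙ¹ = Maybe ℚ

∞ : ℙ¹
∞ = nothing

mob : GL2+ → ℙ¹ → ℙ¹
mob (mat a b c d _) (just r) with c * r + d ≟ 0ℚ
... | yes _ = ∞
... | no ne = just ((a * r + b) * (1/ (c * r + d)) {{≢-nonZero ne}})
mob (mat a b c d _) nothing with c ≟ 0ℚ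
... | yes _ = ∞
... | no ne = just (a * (1/ c) {{≢-nonZero ne}})

private
  open ≡-Reasoning

  notPos0 : ∀ {p} → p ≡ 0ℚ → ¬ Positive p
  notPos0 refl q = <-irrefl refl (positive⁻¹ 0ℚ {{q}})

  cross : ∀ x y u w .{{_ : NonZero y}} .{{_ : NonZero w}} →
          x * 1/ y ≡ u * 1/ w → x * w ≡ u * y
  cross x y u w e = begin
      x * w                       ≡⟨ sym (*-identityʳ (x * w)) ⟩
      x * w * 1ℚ                  ≡⟨ cong (x * w *_) (sym (*-inverseʳ y)) ⟩
      x * w * (y * 1/ y)          ≡⟨ solve 4 (λ x w y iy → x :* w :* (y :* iy) := x :* iy :* (w :* y)) refl x w y (1/ y) ⟩
      x * 1/ y * (w * y)          ≡⟨ cong (_* (w * y)) e ⟩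
      u * 1/ w * (w * y)          ≡⟨ solve 4 (λ u w y iw → u :* iw :* (w :* y) := u :* y :* (w :* iw)) refl u w y (1/ w) ⟩
      u * y * (w * 1/ w)          ≡⟨ cong (u * y *_) (*-inverseʳ w) ⟩
      u * y * 1ℚ                  ≡⟨ *-identityʳ (u * y) ⟩
      u * y ∎
    where open +-*-Solver

  cancel : ∀ p q → p ≢ 0ℚ → p * q ≡ 0ℚ → q ≡ 0ℚ
  cancel p q ne e = begin
      q                 ≡⟨ sym (*-identityˡ q) ⟩
      1ℚ * q            ≡⟨ cong (_* q) (sym (*-inverseˡ p {{≢-nonZero ne}})) ⟩
      ip * p * q        ≡⟨ *-assoc ip p q ⟩
      ip * (p * q)      ≡⟨ cong (ip *_) e ⟩
      ip * 0ℚ           ≡⟨ *-zeroʳ ip ⟩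
      0ℚ ∎
    where
    ip = (1/ p) {{≢-nonZero ne}}

  diff0 : ∀ r s → r - s ≡ 0ℚ → r ≡ s
  diff0 r s e = begin
      r               ≡⟨ solve 2 (λ r s → r := (r :- s) :+ s) refl r s ⟩
      (r - s) + s     ≡⟨ cong (_+ s) e ⟩
      0ℚ + s          ≡⟨ +-identityˡ s ⟩
      s ∎
    where open +-*-Solver

  same0 : ∀ x y → x ≡ y → x - y ≡ 0ℚ
  same0 x .x refl = +-inverseʳ x

mob-inj : ∀ γ {x y} → mob γ x ≡ mob γ y → x ≡ y
mob-inj (mat a b c d p) {just r} {just s} e
  with c * r + d ≟ 0ℚ | c * s + d ≟ 0ℚ
... | yes er | yes es with c ≟ 0ℚ
...   | yes c0 = ⊥-elim-irr (notPos0 Δ0 p)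
  where
  open +-*-Solver
  d0 : d ≡ 0ℚ
  d0 = trans (solve 3 (λ c r d → d := c :* r :+ d :- c :* r) refl c r d)
         (trans (cong₂ (λ u v → u - v * r) er c0) (solve 1 (λ r → con 0ℚ :- con 0ℚ :* r := con 0ℚ) refl r))
  Δ0 : det a b c d ≡ 0ℚ
  Δ0 = trans (cong₂ (λ u v → a * u - b * v) d0 c0)
         (solve 2 (λ a b → a :* con 0ℚ :- b :* con 0ℚ := con 0ℚ) refl a b)
...   | no c≠0 = cong just (diff0 r s (cancel c (r - s) c≠0 eq))
  where
  open +-*-Solver
  eq : c * (r - s) ≡ 0ℚ
  eq = trans (solve 4 (λ c r s d → c :* (r :- s) := (c :* r :+ d) :- (c :* s :+ d)) refl c r s d)
         (trans (cong₂ _-_ er es) (solve 0 (con 0ℚ :- con 0ℚ := con 0ℚ) refl))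
mob-inj (mat a b c d p) {just r} {just s} () | yes er | no es
mob-inj (mat a b c d p) {just r} {just s} () | no er | yes es
mob-inj (mat a b c d p) {just r} {just s} e | no er | no es =
  cong just (diff0 r s (cancel Δ (r - s) Δ≠0 eq))
  where
  open +-*-Solver
  Δ = det a b c d
  Δ≠0 : Δ ≢ 0ℚ
  Δ≠0 z = ⊥-elim-irr (notPos0 z p)
  cr = cross (a * r + b) (c * r + d) (a * s + b) (c * s + d)
         {{≢-nonZero er}} {{≢-nonZero es}} (MaybeP.just-injective e)
  eq : Δ * (r - s) ≡ 0ℚ
  eq = trans (solve 6 (λ a b c d r s →
           (a :* d :- b :* c) :* (r :- s)
           := (a :* r :+ b) :* (c :* s :+ d) :- (a :* s :+ b) :* (c :* r :+ d))
           refl a b c d r s)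
         (same0 _ _ cr)
mob-inj (mat a b c d p) {nothing} {nothing} e = refl
mob-inj (mat a b c d p) {nothing} {just s} e
  with c ≟ 0ℚ | c * s + d ≟ 0ℚ
... | yes c0 | yes es = ⊥-elim-irr (notPos0 Δ0 p)
  where
  open +-*-Solver
  d0 : d ≡ 0ℚ
  d0 = trans (solve 3 (λ c s d → d := c :* s :+ d :- c :* s) refl c s d)
         (trans (cong₂ (λ u v → u - v * s) es c0) (solve 1 (λ r → con 0ℚ :- con 0ℚ :* r := con 0ℚ) refl s))
  Δ0 : det a b c d ≡ 0ℚ
  Δ0 = trans (cong₂ (λ u v → a * u - b * v) d0 c0)
         (solve 2 (λ a b → a :* con 0ℚ :- b :* con 0ℚ := con 0ℚ) refl a b)
mob-inj (mat a b c d p) {nothing} {just s} () | yes c0 | no es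
mob-inj (mat a b c d p) {nothing} {just s} () | no c≠0 | yes es
mob-inj (mat a b c d p) {nothing} {just s} e | no c≠0 | no es =
  ⊥-elim-irr (notPos0 Δ0 p)
  where
  open +-*-Solver
  cr = cross a c (a * s + b) (c * s + d)
         {{≢-nonZero c≠0}} {{≢-nonZero es}} (MaybeP.just-injective e)
  Δ0 : det a b c d ≡ 0ℚ
  Δ0 = trans (solve 5 (λ a b c d s →
           a :* d :- b :* c := a :* (c :* s :+ d) :- (a :* s :+ b) :* c)
           refl a b c d s) (same0 _ _ cr)
mob-inj γ {just r} {nothing} e = sym (mob-inj γ {nothing} {just r} (sym e))

-- 𝒫(ℚ): formal symbols π_r(s) with r ≠ s in ℙ¹(ℚ), and the G-action
-- γ π_r(s) = π_{γr}(γs).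

record Sym : Set where
  constructor π
  field
    r s : ℙ¹
    .distinct : r ≢ s

infixr 9 _·ₛ_
_·ₛ_ : GL2+ → Sym → Sym
γ ·ₛ π r s ne = π (mob γ r) (mob γ s) (λ e → ne (mob-inj γ e))

_≟ₛ_ : (x y : Sym) → Relation.Nullary.Dec (x ≡ y)
π r s _ ≟ₛ π r' s' _ with MaybeP.≡-dec _≟_ r r' | MaybeP.≡-dec _≟_ s s'
... | yes refl | yes refl = yes refl
... | no ne | _ = no (λ e → ne (cong Sym.r e))
... | _ | no ne = no (λ e → ne (cong Sym.s e))

-- Divisors on 𝒫(ℚ): finite formal ℤ-combinations, represented by lists
-- of (coefficient , symbol); two divisors are equal iff all their
-- coefficients agree.  Ξ₀ = divisors of degree zero.

Div : Set
Div = List (ℤ × Sym)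

coeff : Div → Sym → ℤ
coeff [] x = ℤ.0ℤ
coeff ((n , y) ∷ D) x with y ≟ₛ x
... | yes _ = n ℤ.+ coeff D x
... | no _ = coeff D x

deg : Div → ℤ
deg [] = ℤ.0ℤ
deg ((n , _) ∷ D) = n ℤ.+ deg D

deg-++ : ∀ D E → deg (D ++ E) ≡ deg D ℤ.+ deg E
deg-++ [] E = sym (ℤP.+-identityˡ (deg E))
deg-++ ((n , _) ∷ D) E = trans (cong (λ k → n ℤ.+ k) (deg-++ D E)) (sym (ℤP.+-assoc n (deg D) (deg E)))

translate : GL2+ → Div → Div
translate γ = map (λ { (n , x) → n , γ ·ₛ x })

deg-translate : ∀ γ D → deg (translate γ D) ≡ deg D
deg-translate γ [] = refl
deg-translate γ ((n , _) ∷ D) = cong (λ k → n ℤ.+ k) (deg-translate γ D)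

record Ξ₀ : Set where
  constructor ⟨_⟩
  field
    div : Div
    .deg0 : deg div ≡ ℤ.0ℤ

open Ξ₀ public

_≋_ : Ξ₀ → Ξ₀ → Set
D ≋ E = ∀ x → coeff (div D) x ≡ coeff (div E) x

_⊕_ : Ξ₀ → Ξ₀ → Ξ₀
⟨ D ⟩ p ⊕ ⟨ E ⟩ q = ⟨ D ++ E ⟩ (trans (deg-++ D E) (trans (cong₂ ℤ._+_ p q) refl))

infixr 9 _·Ξ_
_·Ξ_ : GL2+ → Ξ₀ → Ξ₀
γ ·Ξ ⟨ D ⟩ p = ⟨ translate γ D ⟩ (trans (deg-translate γ D) p)

[_,_] : Sym → Sym → Ξ₀
[ c₁ , c₂ ] = ⟨ (ℤ.+ 1 , c₂) ∷ (ℤ.-[1+ 0 ] , c₁) ∷ [] ⟩ refl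

ℚ-ring = +-*-commutativeRing

record RightRep (m ℓ : Level) : Set (suc (m ⊔ ℓ)) where
  field
    vs : Module ℚ-ring m ℓ
  open Module vs public
  infixl 8 _∣_
  field
    _∣_   : Carrierᴹ → GL2+ → Carrierᴹ
    ∣-cong : ∀ {v w} γ → v ≈ᴹ w → v ∣ γ ≈ᴹ w ∣ γ
    ∣-+    : ∀ v w γ → (v +ᴹ w) ∣ γ ≈ᴹ v ∣ γ +ᴹ w ∣ γ
    ∣-*    : ∀ (q : ℚ) v γ → (q *ₗ v) ∣ γ ≈ᴹ q *ₗ (v ∣ γ)
    ∣-𝟙    : ∀ v → v ∣ 𝟙 ≈ᴹ v
    ∣-∙    : ∀ v γ₁ γ₂ → v ∣ (γ₁ ∙ γ₂) ≈ᴹ (v ∣ γ₁) ∣ γ₂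

  _∣[_-1] : Carrierᴹ → GL2+ → Carrierᴹ
  v ∣[ γ -1] = v ∣ γ +ᴹ (-ᴹ v)

module _ {m ℓ : Level} (V : RightRep m ℓ) where
  open RightRep V

  InvG : Carrierᴹ → Set ℓ
  InvG v = ∀ γ → v ∣ γ ≈ᴹ v

  InStab : Sym → GL2+ → Set
  InStab Z γ = γ ·ₛ Z ≡ Z

  InvS : Sym → Carrierᴹ → Set ℓ
  InvS Z v = ∀ γ → InStab Z γ → v ∣ γ ≈ᴹ v

  record HomG : Set (m ⊔ ℓ) where
    field
      ψ      : Ξ₀ → Carrierᴹ
      ψ-resp : ∀ D E → D ≋ E → ψ D ≈ᴹ ψ E
      ψ-hom  : ∀ D E → ψ (D ⊕ E) ≈ᴹ ψ D +ᴹ ψ E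
      ψ-G    : ∀ γ D → ψ (γ ·Ξ D) ≈ᴹ ψ D ∣ (γ ⁻¹)

  IsImage : Sym → Carrierᴹ → HomG → Set ℓ
  IsImage Z v Ψ = ∀ γ → HomG.ψ Ψ [ Z , (γ ⁻¹) ·ₛ Z ] ≈ᴹ v ∣[ γ -1]

  IsCocycle : (GL2+ → Carrierᴹ) → Set ℓ
  IsCocycle f = ∀ γ₁ γ₂ → f (γ₁ ∙ γ₂) ≈ᴹ f γ₁ ∣ γ₂ +ᴹ f γ₂

  IsCoboundary : (GL2+ → Carrierᴹ) → Set (m ⊔ ℓ)
  IsCoboundary f = Σ Carrierᴹ λ v → ∀ γ → f γ ≈ᴹ v ∣[ γ -1]

  IsCoboundaryOnStab : Sym → (GL2+ → Carrierᴹ) → Set (m ⊔ ℓ)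
  IsCoboundaryOnStab Z f = Σ Carrierᴹ λ v → ∀ γ → InStab Z γ → f γ ≈ᴹ v ∣[ γ -1]

  U : Sym → HomG → GL2+ → Carrierᴹ
  U Z Ψ γ = HomG.ψ Ψ [ Z , (γ ⁻¹) ·ₛ Z ]

-- G acts transitively on 𝒫(ℚ), so Ξ₀ is generated by the divisors [Z , x] = [Z , γ⁻¹Z] and a
-- G-homomorphism ψ is determined by the cocycle U_Z(ψ) : γ ↦ ψ[Z , γ⁻¹Z], which vanishes on
-- S = Stab(Z) since ψ[Z , Z] = 0.  Conversely a cocycle c vanishing on S gives a well-defined
-- function x = γ⁻¹Z ↦ c(γ) on 𝒫(ℚ), equivariant up to the constants c(γ⁻¹); its ℤ-linear
-- extension to Ξ₀ is a G-homomorphism ψ with U_Z(ψ) = c.  Every exactness statement is one of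
-- these two facts applied to c, to a coboundary, or to a difference of the two.
module Submission where

open import Defs
open import Level using (Level; 0ℓ)
open import Data.Empty using (⊥-elim; ⊥-elim-irr)
open import Data.Product using (Σ; _×_; _,_; proj₁; proj₂)
open import Data.Maybe using (just; nothing)
open import Data.List using ([]; _∷_; _++_; length)
open import Data.Nat as ℕ using (zero; suc; z≤n; s≤s)
import Data.Nat.Properties as ℕ
open import Data.Integer as ℤ using (ℤ; 0ℤ; +_; -[1+_])
import Data.Integer.Properties as ℤ
import Data.Integer.Solver as ℤSolver
open import Data.Rational.Literals using (fromℤ)
open import Data.Rational
  using (ℚ; 0ℚ; 1ℚ; _+_; _*_; _-_; -_; 1/_; Positive; ≢-nonZero; _<_; positive)
open import Data.Rational.Properties
  using (_≟_; toℚᵘ-injective; toℚᵘ-homo-+; *-inverseʳ; *-inverseˡ; pos⇒nonZero; positive⁻¹; <-irrefl; <-cmp;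
         *-identityˡ; *-identityʳ; *-assoc; *-zeroʳ; *-zeroˡ; +-inverseʳ; +-monoˡ-<)
open import Data.Rational.Solver using (module +-*-Solver)
import Data.Rational.Unnormalised as ℚᵘ
import Data.Rational.Unnormalised.Properties as ℚᵘ
open import Algebra.Bundles using (Group; AbelianGroup)
import Algebra.Properties.Group as GroupProperties
import Algebra.Properties.AbelianGroup as AbelianGroupProperties
import Algebra.Properties.CommutativeSemigroup as CommutativeSemigroupProperties
import Relation.Binary.Reasoning.Setoid as SetoidReasoning
open import Relation.Nullary using (yes; no; ¬_; Dec)
open import Relation.Nullary.Decidable using (recompute)
open import Relation.Binary using (tri<; tri≈; tri>)
open import Relation.Binary.PropositionalEquality
  using (_≡_; _≢_; refl; sym; trans; cong; cong₂; subst; isEquivalence; module ≡-Reasoning)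
open import Function.Bundles using (_⇔_; mk⇔)

module _ where
  open +-*-Solver

  ≡0⇒¬positive : ∀ {p} → p ≡ 0ℚ → ¬ Positive p
  ≡0⇒¬positive refl q = <-irrefl refl (positive⁻¹ 0ℚ {{q}})

  *-zero-cancelˡ : ∀ p q → p ≢ 0ℚ → p * q ≡ 0ℚ → q ≡ 0ℚ
  *-zero-cancelˡ p q p≢0 pq≡0 = begin
      q                 ≡⟨ sym (*-identityˡ q) ⟩
      1ℚ * q            ≡⟨ cong (_* q) (sym (*-inverseˡ p {{≢-nonZero p≢0}})) ⟩
      1/p * p * q       ≡⟨ *-assoc 1/p p q ⟩
      1/p * (p * q)     ≡⟨ cong (1/p *_) pq≡0 ⟩
      1/p * 0ℚ          ≡⟨ *-zeroʳ 1/p ⟩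
      0ℚ ∎
    where
    open ≡-Reasoning
    1/p = (1/ p) {{≢-nonZero p≢0}}

  cross-multiply : ∀ p q p' q' (q≢0 : q ≢ 0ℚ) (q'≢0 : q' ≢ 0ℚ) → p * q' ≡ p' * q →
                   p * (1/ q) {{≢-nonZero q≢0}} ≡ p' * (1/ q') {{≢-nonZero q'≢0}}
  cross-multiply p q p' q' q≢0 q'≢0 e = begin
      p * 1/q                  ≡⟨ sym (*-identityʳ _) ⟩
      p * 1/q * 1ℚ             ≡⟨ cong (p * 1/q *_) (sym (*-inverseʳ q' {{≢-nonZero q'≢0}})) ⟩
      p * 1/q * (q' * 1/q')    ≡⟨ solve 4 (λ p i q' i' → p :* i :* (q' :* i') := (p :* q') :* i :* i') refl p 1/q q' 1/q' ⟩
      (p * q') * 1/q * 1/q'    ≡⟨ cong (λ z → z * 1/q * 1/q') e ⟩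
      (p' * q) * 1/q * 1/q'    ≡⟨ solve 4 (λ p' q i i' → (p' :* q) :* i :* i' := p' :* i' :* (q :* i)) refl p' q 1/q 1/q' ⟩
      p' * 1/q' * (q * 1/q)    ≡⟨ cong (p' * 1/q' *_) (*-inverseʳ q {{≢-nonZero q≢0}}) ⟩
      p' * 1/q' * 1ℚ           ≡⟨ *-identityʳ _ ⟩
      p' * 1/q' ∎
    where
    open ≡-Reasoning
    1/q = (1/ q) {{≢-nonZero q≢0}}
    1/q' = (1/ q') {{≢-nonZero q'≢0}}

  <⇒positive-difference : ∀ r s → r < s → Positive (s - r)
  <⇒positive-difference r s r<s = positive (subst (_< s - r) (+-inverseʳ r) (+-monoˡ-< (- r) r<s))

-- * Homogeneous coordinates on ℙ¹(ℚ)

ratio : (N Q : ℚ) → Dec (Q ≡ 0ℚ) → ℙ¹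
ratio N Q (yes _) = ∞
ratio N Q (no Q≢0) = just ((N * (1/ Q) {{≢-nonZero Q≢0}}))

⟪_∶_⟫ : ℚ → ℚ → ℙ¹
⟪ N ∶ Q ⟫ = ratio N Q (Q ≟ 0ℚ)

module _ where
  open +-*-Solver

  ⟪∶⟫-scale : ∀ N Q u → u ≢ 0ℚ → ⟪ N * u ∶ Q * u ⟫ ≡ ⟪ N ∶ Q ⟫
  ⟪∶⟫-scale N Q u u≢0 = go (Q * u ≟ 0ℚ) (Q ≟ 0ℚ)
    where
    go : (x : Dec (Q * u ≡ 0ℚ)) (y : Dec (Q ≡ 0ℚ)) → ratio (N * u) (Q * u) x ≡ ratio N Q y
    go (yes _) (yes _) = refl
    go (yes Qu≡0) (no Q≢0) =
      ⊥-elim (Q≢0 (*-zero-cancelˡ u Q u≢0 (trans (solve 2 (λ u Q → u :* Q := Q :* u) refl u Q) Qu≡0)))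
    go (no Qu≢0) (yes Q≡0) = ⊥-elim (Qu≢0 (trans (cong (_* u) Q≡0) (*-zeroˡ u)))
    go (no Qu≢0) (no Q≢0) = cong just (cross-multiply (N * u) (Q * u) N Q Qu≢0 Q≢0
          (solve 3 (λ N u Q → N :* u :* Q := N :* (Q :* u)) refl N u Q))

  ⟪∶⟫-finite : ∀ N Q M → Q ≢ 0ℚ → N ≡ M * Q → ⟪ N ∶ Q ⟫ ≡ just M
  ⟪∶⟫-finite N Q M Q≢0 e with Q ≟ 0ℚ
  ... | yes Q≡0 = ⊥-elim (Q≢0 Q≡0)
  ... | no Q≢0' = cong just (trans (cross-multiply N Q M 1ℚ Q≢0' (λ ()) (trans (*-identityʳ N) e)) (*-identityʳ M))

  ⟪∶0⟫ : ∀ N Q → Q ≡ 0ℚ → ⟪ N ∶ Q ⟫ ≡ ∞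
  ⟪∶0⟫ N Q Q≡0 with Q ≟ 0ℚ
  ... | yes _ = refl
  ... | no Q≢0 = ⊥-elim (Q≢0 Q≡0)

  mob-just : ∀ a b c d .(p : Positive (det a b c d)) r →
    mob (mat a b c d p) (just r) ≡ ⟪ a * r + b ∶ c * r + d ⟫
  mob-just a b c d p r with c * r + d ≟ 0ℚ
  ... | yes _ = refl
  ... | no _ = refl

  mob-∞ : ∀ a b c d .(p : Positive (det a b c d)) → mob (mat a b c d p) ∞ ≡ ⟪ a ∶ c ⟫
  mob-∞ a b c d p with c ≟ 0ℚ
  ... | yes _ = refl
  ... | no _ = refl

  mob-⟪∶⟫ : ∀ a b c d .(p : Positive (det a b c d)) n u → ¬ (n ≡ 0ℚ × u ≡ 0ℚ) →
    mob (mat a b c d p) ⟪ n ∶ u ⟫ ≡ ⟪ a * n + b * u ∶ c * n + d * u ⟫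
  mob-⟪∶⟫ a b c d p n u nonzero = go (u ≟ 0ℚ)
    where
    open ≡-Reasoning
    go : (u≟0 : Dec (u ≡ 0ℚ)) → mob (mat a b c d p) (ratio n u u≟0) ≡ ⟪ a * n + b * u ∶ c * n + d * u ⟫
    go (yes u≡0) = begin
        mob (mat a b c d p) ∞           ≡⟨ mob-∞ a b c d p ⟩
        ⟪ a ∶ c ⟫                       ≡⟨ sym (⟪∶⟫-scale a c n (λ n≡0 → nonzero (n≡0 , u≡0))) ⟩
        ⟪ a * n ∶ c * n ⟫               ≡⟨ cong₂ ⟪_∶_⟫ (add-zero a b) (add-zero c d) ⟩
        ⟪ a * n + b * u ∶ c * n + d * u ⟫ ∎
      where
      add-zero : ∀ x y → x * n ≡ x * n + y * u
      add-zero x y = sym (trans (cong (λ z → x * n + y * z) u≡0)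
                              (solve 3 (λ x n y → x :* n :+ y :* con 0ℚ := x :* n) refl x n y))
    go (no u≢0) = begin
        mob (mat a b c d p) (just s)            ≡⟨ mob-just a b c d p s ⟩
        ⟪ a * s + b ∶ c * s + d ⟫               ≡⟨ sym (⟪∶⟫-scale _ _ u u≢0) ⟩
        ⟪ (a * s + b) * u ∶ (c * s + d) * u ⟫   ≡⟨ cong₂ ⟪_∶_⟫ (clear a b) (clear c d) ⟩
        ⟪ a * n + b * u ∶ c * n + d * u ⟫ ∎
      where
      1/u = (1/ u) {{≢-nonZero u≢0}}
      s = n * 1/u
      su≡n : s * u ≡ n
      su≡n = trans (*-assoc n 1/u u) (trans (cong (n *_) (*-inverseˡ u {{≢-nonZero u≢0}})) (*-identityʳ n))
      clear : ∀ x y → (x * s + y) * u ≡ x * n + y * u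
      clear x y = trans (solve 4 (λ x s y u → (x :* s :+ y) :* u := x :* (s :* u) :+ y :* u) refl x s y u)
                        (cong (λ z → x * z + y * u) su≡n)

-- * The action of GL₂⁺(ℚ) on ℙ¹(ℚ) and on 𝒫(ℚ)

module _ where
  open +-*-Solver

  mat-≡ : ∀ {a b c d a' b' c' d'} .{p : Positive (det a b c d)} .{p' : Positive (det a' b' c' d')} →
    a ≡ a' → b ≡ b' → c ≡ c' → d ≡ d' → mat a b c d p ≡ mat a' b' c' d' p'
  mat-≡ refl refl refl refl = refl

  ∙-assoc : ∀ x y z → (x ∙ y) ∙ z ≡ x ∙ (y ∙ z)
  ∙-assoc (mat a b c d _) (mat a' b' c' d' _) (mat a'' b'' c'' d'' _) =
    mat-≡ (entry a b a'' c'') (entry a b b'' d'') (entry c d a'' c'') (entry c d b'' d'')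
    where
    entry : ∀ x y z w → (x * a' + y * c') * z + (x * b' + y * d') * w ≡ x * (a' * z + b' * w) + y * (c' * z + d' * w)
    entry x y z w = solve 8 (λ x y z w a' b' c' d' → (x :* a' :+ y :* c') :* z :+ (x :* b' :+ y :* d') :* w
                      := x :* (a' :* z :+ b' :* w) :+ y :* (c' :* z :+ d' :* w)) refl x y z w a' b' c' d'

  ∙-identityˡ : ∀ x → 𝟙 ∙ x ≡ x
  ∙-identityˡ (mat a b c d _) = mat-≡ (first a c) (first b d) (second a c) (second b d)
    where
    first : ∀ x y → 1ℚ * x + 0ℚ * y ≡ x
    first x y = solve 2 (λ x y → con 1ℚ :* x :+ con 0ℚ :* y := x) refl x y
    second : ∀ x y → 0ℚ * x + 1ℚ * y ≡ y
    second x y = solve 2 (λ x y → con 0ℚ :* x :+ con 1ℚ :* y := y) refl x y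

  ∙-identityʳ : ∀ x → x ∙ 𝟙 ≡ x
  ∙-identityʳ (mat a b c d _) = mat-≡ (first a b) (second a b) (first c d) (second c d)
    where
    first : ∀ x y → x * 1ℚ + y * 0ℚ ≡ x
    first x y = solve 2 (λ x y → x :* con 1ℚ :+ y :* con 0ℚ := x) refl x y
    second : ∀ x y → x * 0ℚ + y * 1ℚ ≡ y
    second x y = solve 2 (λ x y → x :* con 0ℚ :+ y :* con 1ℚ := y) refl x y

  ∙-inverseʳ : ∀ x → x ∙ x ⁻¹ ≡ 𝟙
  ∙-inverseʳ (mat a b c d p) = mat-≡
      (trans (solve 5 (λ a b c d i → a :* (d :* i) :+ b :* (:- c :* i) := (a :* d :- b :* c) :* i) refl a b c d i) Δi≡1)
      (solve 3 (λ a b i → a :* (:- b :* i) :+ b :* (a :* i) := con 0ℚ) refl a b i)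
      (solve 3 (λ c d i → c :* (d :* i) :+ d :* (:- c :* i) := con 0ℚ) refl c d i)
      (trans (solve 5 (λ a b c d i → c :* (:- b :* i) :+ d :* (a :* i) := (a :* d :- b :* c) :* i) refl a b c d i) Δi≡1)
    where
    i = (1/ det a b c d) {{pos⇒nonZero (det a b c d) {{p}}}}
    Δi≡1 : det a b c d * i ≡ 1ℚ
    Δi≡1 = *-inverseʳ (det a b c d) {{pos⇒nonZero (det a b c d) {{p}}}}

  ∙-inverseˡ : ∀ x → x ⁻¹ ∙ x ≡ 𝟙
  ∙-inverseˡ (mat a b c d p) = mat-≡
      (trans (solve 5 (λ a b c d i → (d :* i) :* a :+ (:- b :* i) :* c := (a :* d :- b :* c) :* i) refl a b c d i) Δi≡1)
      (solve 3 (λ b d i → (d :* i) :* b :+ (:- b :* i) :* d := con 0ℚ) refl b d i)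
      (solve 3 (λ a c i → (:- c :* i) :* a :+ (a :* i) :* c := con 0ℚ) refl a c i)
      (trans (solve 5 (λ a b c d i → (:- c :* i) :* b :+ (a :* i) :* d := (a :* d :- b :* c) :* i) refl a b c d i) Δi≡1)
    where
    i = (1/ det a b c d) {{pos⇒nonZero (det a b c d) {{p}}}}
    Δi≡1 : det a b c d * i ≡ 1ℚ
    Δi≡1 = *-inverseʳ (det a b c d) {{pos⇒nonZero (det a b c d) {{p}}}}

GL₂⁺ : Group 0ℓ 0ℓ
GL₂⁺ = record
  { Carrier = GL2+ ; _≈_ = _≡_ ; _∙_ = _∙_ ; ε = 𝟙 ; _⁻¹ = _⁻¹
  ; isGroup = record
    { isMonoid = record
      { isSemigroup = record
        { isMagma = record { isEquivalence = isEquivalence ; ∙-cong = cong₂ _∙_ }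
        ; assoc = ∙-assoc }
      ; identity = ∙-identityˡ , ∙-identityʳ }
    ; inverse = ∙-inverseˡ , ∙-inverseʳ
    ; ⁻¹-cong = cong _⁻¹ } }

open GroupProperties GL₂⁺ using (⁻¹-involutive; ⁻¹-anti-homo-∙; //-rightDividesʳ)

module _ where
  open +-*-Solver
  open ≡-Reasoning

  mob-∙ : ∀ γ δ x → mob (γ ∙ δ) x ≡ mob γ (mob δ x)
  mob-∙ (mat a b c d p) (mat a' b' c' d' p') (just r) = begin
      mob (mat a b c d p ∙ mat a' b' c' d' p') (just r)
        ≡⟨ mob-just _ _ _ _ _ r ⟩
      ⟪ (a * a' + b * c') * r + (a * b' + b * d') ∶ (c * a' + d * c') * r + (c * b' + d * d') ⟫
        ≡⟨ cong₂ ⟪_∶_⟫ (regroup a b) (regroup c d) ⟩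
      ⟪ a * n + b * u ∶ c * n + d * u ⟫
        ≡⟨ sym (mob-⟪∶⟫ a b c d p n u nonzero) ⟩
      mob (mat a b c d p) ⟪ n ∶ u ⟫
        ≡⟨ cong (mob (mat a b c d p)) (sym (mob-just a' b' c' d' p' r)) ⟩
      mob (mat a b c d p) (mob (mat a' b' c' d' p') (just r)) ∎
    where
    n = a' * r + b'
    u = c' * r + d'
    regroup : ∀ x y → (x * a' + y * c') * r + (x * b' + y * d') ≡ x * n + y * u
    regroup x y = solve 7 (λ x y a' b' c' d' r → (x :* a' :+ y :* c') :* r :+ (x :* b' :+ y :* d')
                            := x :* (a' :* r :+ b') :+ y :* (c' :* r :+ d')) refl x y a' b' c' d' r
    nonzero : ¬ (n ≡ 0ℚ × u ≡ 0ℚ)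
    nonzero (n≡0 , u≡0) = ⊥-elim-irr (≡0⇒¬positive det≡0 p')
      where
      det≡0 : det a' b' c' d' ≡ 0ℚ
      det≡0 = trans (solve 5 (λ a' b' c' d' r → a' :* d' :- b' :* c' := a' :* (c' :* r :+ d') :- c' :* (a' :* r :+ b'))
                              refl a' b' c' d' r)
              (trans (cong₂ (λ z w → a' * z - c' * w) u≡0 n≡0)
                     (solve 2 (λ a' c' → a' :* con 0ℚ :- c' :* con 0ℚ := con 0ℚ) refl a' c'))
  mob-∙ (mat a b c d p) (mat a' b' c' d' p') nothing = begin
      mob (mat a b c d p ∙ mat a' b' c' d' p') ∞
        ≡⟨ mob-∞ (a * a' + b * c') (a * b' + b * d') (c * a' + d * c') (c * b' + d * d') _ ⟩
      ⟪ a * a' + b * c' ∶ c * a' + d * c' ⟫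
        ≡⟨ sym (mob-⟪∶⟫ a b c d p a' c' nonzero) ⟩
      mob (mat a b c d p) ⟪ a' ∶ c' ⟫
        ≡⟨ cong (mob (mat a b c d p)) (sym (mob-∞ a' b' c' d' p')) ⟩
      mob (mat a b c d p) (mob (mat a' b' c' d' p') ∞) ∎
    where
    nonzero : ¬ (a' ≡ 0ℚ × c' ≡ 0ℚ)
    nonzero (a'≡0 , c'≡0) = ⊥-elim-irr (≡0⇒¬positive det≡0 p')
      where
      det≡0 : det a' b' c' d' ≡ 0ℚ
      det≡0 = trans (cong₂ (λ z w → z * d' - b' * w) a'≡0 c'≡0)
                    (solve 2 (λ b' d' → con 0ℚ :* d' :- b' :* con 0ℚ := con 0ℚ) refl b' d')

  -- mob 𝟙 is injective and idempotent, hence the identity.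
  mob-𝟙 : ∀ x → mob 𝟙 x ≡ x
  mob-𝟙 x = mob-inj 𝟙 (trans (sym (mob-∙ 𝟙 𝟙 x)) (cong (λ g → mob g x) (∙-identityʳ 𝟙)))

π-≡ : ∀ {r s r' s'} .{p : r ≢ s} .{p' : r' ≢ s'} → r ≡ r' → s ≡ s' → π r s p ≡ π r' s' p'
π-≡ refl refl = refl

·ₛ-∙ : ∀ γ δ x → (γ ∙ δ) ·ₛ x ≡ γ ·ₛ (δ ·ₛ x)
·ₛ-∙ γ δ (π r s _) = π-≡ (mob-∙ γ δ r) (mob-∙ γ δ s)

·ₛ-𝟙 : ∀ x → 𝟙 ·ₛ x ≡ x
·ₛ-𝟙 (π r s _) = π-≡ (mob-𝟙 r) (mob-𝟙 s)

⁻¹·ₛ-cancel : ∀ γ x → (γ ⁻¹) ·ₛ (γ ·ₛ x) ≡ x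
⁻¹·ₛ-cancel γ x = trans (sym (·ₛ-∙ (γ ⁻¹) γ x)) (trans (cong (_·ₛ x) (∙-inverseˡ γ)) (·ₛ-𝟙 x))

fixes-⁻¹ : ∀ γ x → γ ·ₛ x ≡ x → (γ ⁻¹) ·ₛ x ≡ x
fixes-⁻¹ γ x γx≡x = trans (cong ((γ ⁻¹) ·ₛ_) (sym γx≡x)) (⁻¹·ₛ-cancel γ x)

π∞0 : Sym
π∞0 = π ∞ (just 0ℚ) (λ ())

-- The columns are homogeneous coordinates of r = g ∞ and s = g 0, signed to make det g positive.
moves-π∞0 : ∀ x → Σ GL2+ (λ g → g ·ₛ π∞0 ≡ x)
moves-π∞0 (π nothing nothing ∞≢∞) = ⊥-elim-irr (∞≢∞ refl)
moves-π∞0 (π nothing (just s) _) = mat 1ℚ s 0ℚ 1ℚ det-pos , π-≡ (⟪∶0⟫ 1ℚ 0ℚ refl)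
    (⟪∶⟫-finite (1ℚ * 0ℚ + s) (0ℚ * 0ℚ + 1ℚ) s (λ ())
      (solve 1 (λ s → con 1ℚ :* con 0ℚ :+ s := s :* (con 0ℚ :* con 0ℚ :+ con 1ℚ)) refl s))
  where
  open +-*-Solver
  det-pos : Positive (det 1ℚ s 0ℚ 1ℚ)
  det-pos = subst Positive (solve 1 (λ s → con 1ℚ := con 1ℚ :* con 1ℚ :- s :* con 0ℚ) refl s) _
moves-π∞0 (π (just r) nothing _) = mat r (- 1ℚ) 1ℚ 0ℚ det-pos , π-≡
    (⟪∶⟫-finite r 1ℚ r (λ ()) (sym (*-identityʳ r)))
    (⟪∶0⟫ (r * 0ℚ + - 1ℚ) (1ℚ * 0ℚ + 0ℚ) refl)
  where
  open +-*-Solver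
  det-pos : Positive (det r (- 1ℚ) 1ℚ 0ℚ)
  det-pos = subst Positive (solve 1 (λ r → con 1ℚ := r :* con 0ℚ :- (:- con 1ℚ) :* con 1ℚ) refl r) _
moves-π∞0 (π (just r) (just s) r≢s) with <-cmp r s
... | tri≈ _ r≡s _ = ⊥-elim-irr (r≢s (cong just r≡s))
... | tri< r<s _ _ = mat (- r) s (- 1ℚ) 1ℚ det-pos , π-≡
    (⟪∶⟫-finite (- r) (- 1ℚ) r (λ ()) (solve 1 (λ r → :- r := r :* (:- con 1ℚ)) refl r))
    (⟪∶⟫-finite (- r * 0ℚ + s) (- 1ℚ * 0ℚ + 1ℚ) s (λ ())
      (solve 2 (λ r s → :- r :* con 0ℚ :+ s := s :* (:- con 1ℚ :* con 0ℚ :+ con 1ℚ)) refl r s))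
  where
  open +-*-Solver
  det-pos : Positive (det (- r) s (- 1ℚ) 1ℚ)
  det-pos = subst Positive (solve 2 (λ r s → s :- r := (:- r) :* con 1ℚ :- s :* (:- con 1ℚ)) refl r s)
                  (<⇒positive-difference r s r<s)
... | tri> _ _ s<r = mat r s 1ℚ 1ℚ det-pos , π-≡
    (⟪∶⟫-finite r 1ℚ r (λ ()) (sym (*-identityʳ r)))
    (⟪∶⟫-finite (r * 0ℚ + s) (1ℚ * 0ℚ + 1ℚ) s (λ ())
      (solve 2 (λ r s → r :* con 0ℚ :+ s := s :* (con 1ℚ :* con 0ℚ :+ con 1ℚ)) refl r s))
  where
  open +-*-Solver
  det-pos : Positive (det r s 1ℚ 1ℚ)
  det-pos = subst Positive (solve 2 (λ r s → r :- s := r :* con 1ℚ :- s :* con 1ℚ) refl r s)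
                  (<⇒positive-difference s r s<r)

·ₛ-transitive : ∀ x y → Σ GL2+ (λ g → g ·ₛ x ≡ y)
·ₛ-transitive x y with moves-π∞0 x | moves-π∞0 y
... | g , gπ≡x | h , hπ≡y = h ∙ g ⁻¹ , (begin
    (h ∙ g ⁻¹) ·ₛ x               ≡⟨ ·ₛ-∙ h (g ⁻¹) x ⟩
    h ·ₛ ((g ⁻¹) ·ₛ x)            ≡⟨ cong (λ z → h ·ₛ ((g ⁻¹) ·ₛ z)) (sym gπ≡x) ⟩
    h ·ₛ ((g ⁻¹) ·ₛ (g ·ₛ π∞0))   ≡⟨ cong (h ·ₛ_) (⁻¹·ₛ-cancel g π∞0) ⟩
    h ·ₛ π∞0                      ≡⟨ hπ≡y ⟩
    y ∎)
  where open ≡-Reasoning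

-- * Divisors and their ℤ-linear functionals

δ : ∀ {A : Set} → Dec A → ℤ → ℤ
δ (yes _) n = n
δ (no _) _ = 0ℤ

δ-+ : ∀ {A : Set} (a? : Dec A) m n → δ a? (m ℤ.+ n) ≡ δ a? m ℤ.+ δ a? n
δ-+ (yes _) m n = refl
δ-+ (no _) m n = refl

δ-neg : ∀ {A : Set} (a? : Dec A) n → δ a? (ℤ.- n) ≡ ℤ.- δ a? n
δ-neg (yes _) n = refl
δ-neg (no _) n = refl

δ-0 : ∀ {A : Set} (a? : Dec A) → δ a? 0ℤ ≡ 0ℤ
δ-0 (yes _) = refl
δ-0 (no _) = refl

coeff-∷ : ∀ n x L y → coeff ((n , x) ∷ L) y ≡ δ (x ≟ₛ y) n ℤ.+ coeff L y
coeff-∷ n x L y with x ≟ₛ y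
... | yes _ = refl
... | no _ = sym (ℤ.+-identityˡ _)

coeff-++ : ∀ L L' y → coeff (L ++ L') y ≡ coeff L y ℤ.+ coeff L' y
coeff-++ [] L' y = sym (ℤ.+-identityˡ _)
coeff-++ ((n , x) ∷ L) L' y = begin
    coeff ((n , x) ∷ L ++ L') y                    ≡⟨ coeff-∷ n x (L ++ L') y ⟩
    δ (x ≟ₛ y) n ℤ.+ coeff (L ++ L') y            ≡⟨ cong (λ k → δ (x ≟ₛ y) n ℤ.+ k) (coeff-++ L L' y) ⟩
    δ (x ≟ₛ y) n ℤ.+ (coeff L y ℤ.+ coeff L' y)   ≡⟨ sym (ℤ.+-assoc (δ (x ≟ₛ y) n) (coeff L y) (coeff L' y)) ⟩
    (δ (x ≟ₛ y) n ℤ.+ coeff L y) ℤ.+ coeff L' y   ≡⟨ cong (ℤ._+ coeff L' y) (sym (coeff-∷ n x L y)) ⟩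
    coeff ((n , x) ∷ L) y ℤ.+ coeff L' y ∎
  where open ≡-Reasoning

coeff-[,] : ∀ a b y → coeff (div [ a , b ]) y ≡ δ (b ≟ₛ y) (+ 1) ℤ.+ (ℤ.- δ (a ≟ₛ y) (+ 1) ℤ.+ 0ℤ)
coeff-[,] a b y = trans (coeff-∷ _ b _ y)
  (cong (λ k → δ (b ≟ₛ y) (+ 1) ℤ.+ k) (trans (coeff-∷ _ a [] y) (cong (ℤ._+ 0ℤ) (δ-neg (a ≟ₛ y) (+ 1)))))

[,]-chasles : ∀ a b c → [ a , c ] ≋ ([ a , b ] ⊕ [ b , c ])
[,]-chasles a b c y = begin
    coeff (div [ a , c ]) y
      ≡⟨ coeff-[,] a c y ⟩
    C ℤ.+ (ℤ.- A ℤ.+ 0ℤ)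
      ≡⟨ solve 3 (λ A B C → C :+ (:- A :+ con 0ℤ) := (B :+ (:- A :+ con 0ℤ)) :+ (C :+ (:- B :+ con 0ℤ))) refl A B C ⟩
    (B ℤ.+ (ℤ.- A ℤ.+ 0ℤ)) ℤ.+ (C ℤ.+ (ℤ.- B ℤ.+ 0ℤ))
      ≡⟨ sym (cong₂ ℤ._+_ (coeff-[,] a b y) (coeff-[,] b c y)) ⟩
    coeff (div [ a , b ]) y ℤ.+ coeff (div [ b , c ]) y
      ≡⟨ sym (coeff-++ (div [ a , b ]) (div [ b , c ]) y) ⟩
    coeff (div ([ a , b ] ⊕ [ b , c ])) y ∎
  where
  open ≡-Reasoning
  open ℤSolver.+-*-Solver
  A = δ (a ≟ₛ y) (+ 1)
  B = δ (b ≟ₛ y) (+ 1)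
  C = δ (c ≟ₛ y) (+ 1)

coeff-[a,a] : ∀ a y → coeff (div [ a , a ]) y ≡ 0ℤ
coeff-[a,a] a y = trans (coeff-[,] a a y) (cancel (a ≟ₛ y))
  where
  cancel : ∀ {A : Set} (a? : Dec A) → δ a? (+ 1) ℤ.+ (ℤ.- δ a? (+ 1) ℤ.+ 0ℤ) ≡ 0ℤ
  cancel (yes _) = refl
  cancel (no _) = refl

remove : Sym → Div → Div
remove x [] = []
remove x ((n , y) ∷ L) with y ≟ₛ x
... | yes _ = remove x L
... | no _ = (n , y) ∷ remove x L

length-remove : ∀ x L → length (remove x L) ℕ.≤ length L
length-remove x [] = z≤n
length-remove x ((n , y) ∷ L) with y ≟ₛ x
... | yes _ = ℕ.m≤n⇒m≤1+n (length-remove x L)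
... | no _ = s≤s (length-remove x L)

remove-∷ : ∀ x n L → remove x ((n , x) ∷ L) ≡ remove x L
remove-∷ x n L with x ≟ₛ x
... | yes _ = refl
... | no x≢x = ⊥-elim (x≢x refl)

coeff-∷-≢ : ∀ n x L y → x ≢ y → coeff ((n , x) ∷ L) y ≡ coeff L y
coeff-∷-≢ n x L y x≢y with x ≟ₛ y
... | yes x≡y = ⊥-elim (x≢y x≡y)
... | no _ = refl

coeff-remove-≡ : ∀ x L → coeff (remove x L) x ≡ 0ℤ
coeff-remove-≡ x [] = refl
coeff-remove-≡ x ((n , y) ∷ L) with y ≟ₛ x
... | yes _ = coeff-remove-≡ x L
... | no y≢x = trans (coeff-∷-≢ n y (remove x L) x y≢x) (coeff-remove-≡ x L)

coeff-remove-≢ : ∀ x y L → x ≢ y → coeff (remove x L) y ≡ coeff L y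
coeff-remove-≢ x y [] x≢y = refl
coeff-remove-≢ x y ((n , z) ∷ L) x≢y with z ≟ₛ x
... | yes refl = trans (coeff-remove-≢ x y L x≢y) (sym (coeff-∷-≢ n z L y x≢y))
... | no _ with z ≟ₛ y
...   | yes _ = cong (λ k → n ℤ.+ k) (coeff-remove-≢ x y L x≢y)
...   | no _ = coeff-remove-≢ x y L x≢y

remove-≋ : ∀ x L L' → (∀ y → coeff L y ≡ coeff L' y) → ∀ y → coeff (remove x L) y ≡ coeff (remove x L') y
remove-≋ x L L' L≋L' y with x ≟ₛ y
... | yes refl = trans (coeff-remove-≡ x L) (sym (coeff-remove-≡ x L'))
... | no x≢y = trans (coeff-remove-≢ x y L x≢y) (trans (L≋L' y) (sym (coeff-remove-≢ x y L' x≢y)))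

infix 25 _·[_,_]
_·[_,_] : ℤ → Sym → Sym → Ξ₀
n ·[ a , b ] = ⟨ (n , b) ∷ (ℤ.- n , a) ∷ [] ⟩ (trans (cong (λ k → n ℤ.+ k) (ℤ.+-identityʳ (ℤ.- n))) (ℤ.+-inverseʳ n))

coeff-·[,] : ∀ n a b y → coeff (div (n ·[ a , b ])) y ≡ δ (b ≟ₛ y) n ℤ.+ (δ (a ≟ₛ y) (ℤ.- n) ℤ.+ 0ℤ)
coeff-·[,] n a b y = trans (coeff-∷ _ b _ y) (cong (λ k → δ (b ≟ₛ y) n ℤ.+ k) (coeff-∷ _ a [] y))

·[,]-+ : ∀ m n a b → (m ℤ.+ n) ·[ a , b ] ≋ (m ·[ a , b ] ⊕ n ·[ a , b ])
·[,]-+ m n a b y = begin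
    coeff (div ((m ℤ.+ n) ·[ a , b ])) y
      ≡⟨ coeff-·[,] (m ℤ.+ n) a b y ⟩
    δ b? (m ℤ.+ n) ℤ.+ (δ a? (ℤ.- (m ℤ.+ n)) ℤ.+ 0ℤ)
      ≡⟨ cong₂ (λ u v → u ℤ.+ (v ℤ.+ 0ℤ)) (δ-+ b? m n)
               (trans (cong (δ a?) (ℤ.neg-distrib-+ m n)) (δ-+ a? (ℤ.- m) (ℤ.- n))) ⟩
    (δ b? m ℤ.+ δ b? n) ℤ.+ ((δ a? (ℤ.- m) ℤ.+ δ a? (ℤ.- n)) ℤ.+ 0ℤ)
      ≡⟨ solve 4 (λ p q r s → (p :+ q) :+ ((r :+ s) :+ con 0ℤ)
                             := (p :+ (r :+ con 0ℤ)) :+ (q :+ (s :+ con 0ℤ))) refl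
               (δ b? m) (δ b? n) (δ a? (ℤ.- m)) (δ a? (ℤ.- n)) ⟩
    (δ b? m ℤ.+ (δ a? (ℤ.- m) ℤ.+ 0ℤ)) ℤ.+ (δ b? n ℤ.+ (δ a? (ℤ.- n) ℤ.+ 0ℤ))
      ≡⟨ sym (cong₂ ℤ._+_ (coeff-·[,] m a b y) (coeff-·[,] n a b y)) ⟩
    coeff (div (m ·[ a , b ])) y ℤ.+ coeff (div (n ·[ a , b ])) y
      ≡⟨ sym (coeff-++ (div (m ·[ a , b ])) (div (n ·[ a , b ])) y) ⟩
    coeff (div (m ·[ a , b ] ⊕ n ·[ a , b ])) y ∎
  where
  open ≡-Reasoning
  open ℤSolver.+-*-Solver
  a? = a ≟ₛ y
  b? = b ≟ₛ y

-- The divisor Σ nᵢ {xᵢ} rewritten as Σ nᵢ ({xᵢ} − {a}); equal to it in degree zero.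
recentre : Sym → Div → Div
recentre a [] = []
recentre a ((n , x) ∷ L) = (n , x) ∷ (ℤ.- n , a) ∷ recentre a L

deg-recentre : ∀ a L → deg (recentre a L) ≡ 0ℤ
deg-recentre a [] = refl
deg-recentre a ((n , x) ∷ L) =
  trans (cong (λ k → n ℤ.+ (ℤ.- n ℤ.+ k)) (deg-recentre a L))
        (trans (cong (λ k → n ℤ.+ k) (ℤ.+-identityʳ (ℤ.- n))) (ℤ.+-inverseʳ n))

coeff-recentre : ∀ a L y → coeff (recentre a L) y ≡ coeff L y ℤ.+ δ (a ≟ₛ y) (ℤ.- deg L)
coeff-recentre a [] y = sym (cong (λ k → 0ℤ ℤ.+ k) (δ-0 (a ≟ₛ y)))
coeff-recentre a ((n , x) ∷ L) y = begin
    coeff (recentre a ((n , x) ∷ L)) y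
      ≡⟨ coeff-∷ n x _ y ⟩
    X ℤ.+ coeff ((ℤ.- n , a) ∷ recentre a L) y
      ≡⟨ cong (λ k → X ℤ.+ k) (trans (coeff-∷ _ a _ y) (cong (λ k → A ℤ.+ k) (coeff-recentre a L y))) ⟩
    X ℤ.+ (A ℤ.+ (coeff L y ℤ.+ R))
      ≡⟨ solve 4 (λ X A C R → X :+ (A :+ (C :+ R)) := (X :+ C) :+ (A :+ R)) refl X A (coeff L y) R ⟩
    (X ℤ.+ coeff L y) ℤ.+ (A ℤ.+ R)
      ≡⟨ sym (cong₂ ℤ._+_ (coeff-∷ n x L y)
                (trans (cong (δ (a ≟ₛ y)) (ℤ.neg-distrib-+ n (deg L))) (δ-+ (a ≟ₛ y) (ℤ.- n) (ℤ.- deg L)))) ⟩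
    coeff ((n , x) ∷ L) y ℤ.+ δ (a ≟ₛ y) (ℤ.- deg ((n , x) ∷ L)) ∎
  where
  open ≡-Reasoning
  open ℤSolver.+-*-Solver
  X = δ (x ≟ₛ y) n
  A = δ (a ≟ₛ y) (ℤ.- n)
  R = δ (a ≟ₛ y) (ℤ.- deg L)

recentre-≋ : ∀ a D → D ≋ ⟨ recentre a (div D) ⟩ (deg-recentre a (div D))
recentre-≋ a (⟨ L ⟩ deg≡0) y = sym (begin
    coeff (recentre a L) y                   ≡⟨ coeff-recentre a L y ⟩
    coeff L y ℤ.+ δ (a ≟ₛ y) (ℤ.- deg L)     ≡⟨ cong (λ k → coeff L y ℤ.+ δ (a ≟ₛ y) (ℤ.- k)) (recompute (deg L ℤ.≟ 0ℤ) deg≡0) ⟩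
    coeff L y ℤ.+ δ (a ≟ₛ y) 0ℤ              ≡⟨ cong (λ k → coeff L y ℤ.+ k) (δ-0 (a ≟ₛ y)) ⟩
    coeff L y ℤ.+ 0ℤ                         ≡⟨ ℤ.+-identityʳ _ ⟩
    coeff L y ∎)
  where open ≡-Reasoning

fromℤ-+ : ∀ m n → fromℤ (m ℤ.+ n) ≡ fromℤ m + fromℤ n
fromℤ-+ m n = toℚᵘ-injective (ℚᵘ.≃-trans (ℚᵘ.*≡* cross-products) (ℚᵘ.≃-sym (toℚᵘ-homo-+ (fromℤ m) (fromℤ n))))
  where
  open ℤSolver.+-*-Solver
  cross-products : (m ℤ.+ n) ℤ.* + 1 ≡ (m ℤ.* + 1 ℤ.+ n ℤ.* + 1) ℤ.* + 1
  cross-products = solve 2 (λ m n → (m :+ n) :* con (+ 1) := (m :* con (+ 1) :+ n :* con (+ 1)) :* con (+ 1)) refl m n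

module LinearExtension {m ℓ : Level} (V : RightRep m ℓ) where
  open RightRep V
  open SetoidReasoning ≈ᴹ-setoid
  module +ᴹ = AbelianGroupProperties +ᴹ-abelianGroup
  open CommutativeSemigroupProperties (AbelianGroup.commutativeSemigroup +ᴹ-abelianGroup)
    using (interchange)

  fromℤ-*ₗ-+ : ∀ p q v → fromℤ (p ℤ.+ q) *ₗ v ≈ᴹ fromℤ p *ₗ v +ᴹ fromℤ q *ₗ v
  fromℤ-*ₗ-+ p q v = ≈ᴹ-trans (≈ᴹ-reflexive (cong (_*ₗ v) (fromℤ-+ p q))) (*ₗ-distribʳ v (fromℤ p) (fromℤ q))

  fromℤ-1-*ₗ : ∀ v → fromℤ (+ 1) *ₗ v ≈ᴹ v
  fromℤ-1-*ₗ = *ₗ-identityˡ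

  fromℤ-[-1]-*ₗ : ∀ v → fromℤ -[1+ 0 ] *ₗ v ≈ᴹ -ᴹ v
  fromℤ-[-1]-*ₗ v = +ᴹ.inverseʳ-unique v _ (begin
    v +ᴹ fromℤ -[1+ 0 ] *ₗ v                    ≈⟨ +ᴹ-congʳ (fromℤ-1-*ₗ v) ⟨
    fromℤ (+ 1) *ₗ v +ᴹ fromℤ -[1+ 0 ] *ₗ v      ≈⟨ fromℤ-*ₗ-+ (+ 1) -[1+ 0 ] v ⟨
    fromℤ 0ℤ *ₗ v                              ≈⟨ *ₗ-zeroˡ v ⟩
    0ᴹ ∎)

  0ᴹ-∣ : ∀ γ → 0ᴹ ∣ γ ≈ᴹ 0ᴹ
  0ᴹ-∣ γ = begin
    0ᴹ ∣ γ            ≈⟨ ∣-cong γ (*ₗ-zeroʳ 0ℚ) ⟨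
    (0ℚ *ₗ 0ᴹ) ∣ γ    ≈⟨ ∣-* 0ℚ 0ᴹ γ ⟩
    0ℚ *ₗ (0ᴹ ∣ γ)    ≈⟨ *ₗ-zeroˡ _ ⟩
    0ᴹ ∎

  extend : (Sym → Carrierᴹ) → Div → Carrierᴹ
  extend φ [] = 0ᴹ
  extend φ ((n , x) ∷ L) = fromℤ n *ₗ φ x +ᴹ extend φ L

  extend-++ : ∀ φ L L' → extend φ (L ++ L') ≈ᴹ extend φ L +ᴹ extend φ L'
  extend-++ φ [] L' = ≈ᴹ-sym (+ᴹ-identityˡ _)
  extend-++ φ ((n , x) ∷ L) L' = ≈ᴹ-trans (+ᴹ-congˡ (extend-++ φ L L')) (≈ᴹ-sym (+ᴹ-assoc _ _ _))

  extend-[,] : ∀ φ a b → extend φ (div [ a , b ]) ≈ᴹ φ b +ᴹ -ᴹ φ a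
  extend-[,] φ a b = +ᴹ-cong (fromℤ-1-*ₗ (φ b)) (≈ᴹ-trans (+ᴹ-identityʳ _) (fromℤ-[-1]-*ₗ (φ a)))

  extend-remove : ∀ φ x L → extend φ L ≈ᴹ fromℤ (coeff L x) *ₗ φ x +ᴹ extend φ (remove x L)
  extend-remove φ x [] = ≈ᴹ-sym (≈ᴹ-trans (+ᴹ-congʳ (*ₗ-zeroˡ (φ x))) (+ᴹ-identityˡ 0ᴹ))
  extend-remove φ x ((n , y) ∷ L) with y ≟ₛ x
  ... | yes refl = begin
      fromℤ n *ₗ φ y +ᴹ extend φ L
        ≈⟨ +ᴹ-congˡ (extend-remove φ y L) ⟩
      fromℤ n *ₗ φ y +ᴹ (fromℤ (coeff L y) *ₗ φ y +ᴹ extend φ (remove y L))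
        ≈⟨ +ᴹ-assoc _ _ _ ⟨
      (fromℤ n *ₗ φ y +ᴹ fromℤ (coeff L y) *ₗ φ y) +ᴹ extend φ (remove y L)
        ≈⟨ +ᴹ-congʳ (fromℤ-*ₗ-+ n (coeff L y) (φ y)) ⟨
      fromℤ (n ℤ.+ coeff L y) *ₗ φ y +ᴹ extend φ (remove y L) ∎
  ... | no _ = begin
      fromℤ n *ₗ φ y +ᴹ extend φ L
        ≈⟨ +ᴹ-congˡ (extend-remove φ x L) ⟩
      fromℤ n *ₗ φ y +ᴹ (fromℤ (coeff L x) *ₗ φ x +ᴹ extend φ (remove x L))
        ≈⟨ +ᴹ-assoc _ _ _ ⟨
      (fromℤ n *ₗ φ y +ᴹ fromℤ (coeff L x) *ₗ φ x) +ᴹ extend φ (remove x L)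
        ≈⟨ +ᴹ-congʳ (+ᴹ-comm _ _) ⟩
      (fromℤ (coeff L x) *ₗ φ x +ᴹ fromℤ n *ₗ φ y) +ᴹ extend φ (remove x L)
        ≈⟨ +ᴹ-assoc _ _ _ ⟩
      fromℤ (coeff L x) *ₗ φ x +ᴹ (fromℤ n *ₗ φ y +ᴹ extend φ (remove x L)) ∎

  extend-≋ : ∀ φ L L' → (∀ y → coeff L y ≡ coeff L' y) → extend φ L ≈ᴹ extend φ L'
  extend-≋ φ L L' = bounded (length L ℕ.+ length L') L L' ℕ.≤-refl
    where
    peel : ∀ x L L' → (∀ y → coeff L y ≡ coeff L' y) →
           extend φ (remove x L) ≈ᴹ extend φ (remove x L') → extend φ L ≈ᴹ extend φ L'
    peel x L L' L≋L' rest = begin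
      extend φ L                                             ≈⟨ extend-remove φ x L ⟩
      fromℤ (coeff L x) *ₗ φ x +ᴹ extend φ (remove x L)      ≈⟨ +ᴹ-cong (≈ᴹ-reflexive (cong (λ k → fromℤ k *ₗ φ x) (L≋L' x))) rest ⟩
      fromℤ (coeff L' x) *ₗ φ x +ᴹ extend φ (remove x L')    ≈⟨ extend-remove φ x L' ⟨
      extend φ L' ∎

    bounded : ∀ k L L' → length L ℕ.+ length L' ℕ.≤ k → (∀ y → coeff L y ≡ coeff L' y) → extend φ L ≈ᴹ extend φ L'
    bounded k [] [] _ _ = ≈ᴹ-refl
    bounded (suc k) ((n , x) ∷ L) L' (s≤s size) L≋L' =
      peel x ((n , x) ∷ L) L' L≋L'
        (bounded k (remove x ((n , x) ∷ L)) (remove x L')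
          (subst (λ R → length R ℕ.+ length (remove x L') ℕ.≤ k) (sym (remove-∷ x n L))
            (ℕ.≤-trans (ℕ.+-mono-≤ (length-remove x L) (length-remove x L')) size))
          (remove-≋ x ((n , x) ∷ L) L' L≋L'))
    bounded (suc k) [] ((n , x) ∷ L') size L≋L' =
      peel x [] ((n , x) ∷ L') L≋L'
        (bounded k [] (remove x ((n , x) ∷ L'))
          (subst (λ R → length R ℕ.≤ k) (sym (remove-∷ x n L'))
            (ℕ.≤-trans (length-remove x L') (ℕ.≤-pred size)))
          (remove-≋ x [] ((n , x) ∷ L') L≋L'))

  extend-translate : ∀ φ γ w → (∀ x → φ (γ ·ₛ x) ≈ᴹ φ x ∣ (γ ⁻¹) +ᴹ w) →
    ∀ L → extend φ (translate γ L) ≈ᴹ extend φ L ∣ (γ ⁻¹) +ᴹ fromℤ (deg L) *ₗ w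
  extend-translate φ γ w φ-γ [] = ≈ᴹ-sym (≈ᴹ-trans (+ᴹ-cong (0ᴹ-∣ (γ ⁻¹)) (*ₗ-zeroˡ w)) (+ᴹ-identityˡ 0ᴹ))
  extend-translate φ γ w φ-γ ((n , x) ∷ L) = begin
    fromℤ n *ₗ φ (γ ·ₛ x) +ᴹ extend φ (translate γ L)
      ≈⟨ +ᴹ-cong (*ₗ-congˡ (φ-γ x)) (extend-translate φ γ w φ-γ L) ⟩
    fromℤ n *ₗ (φ x ∣ g +ᴹ w) +ᴹ (extend φ L ∣ g +ᴹ fromℤ (deg L) *ₗ w)
      ≈⟨ +ᴹ-congʳ (*ₗ-distribˡ (fromℤ n) _ _) ⟩
    (fromℤ n *ₗ (φ x ∣ g) +ᴹ fromℤ n *ₗ w) +ᴹ (extend φ L ∣ g +ᴹ fromℤ (deg L) *ₗ w)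
      ≈⟨ interchange _ _ _ _ ⟩
    (fromℤ n *ₗ (φ x ∣ g) +ᴹ extend φ L ∣ g) +ᴹ (fromℤ n *ₗ w +ᴹ fromℤ (deg L) *ₗ w)
      ≈⟨ +ᴹ-cong (+ᴹ-congʳ (∣-* (fromℤ n) (φ x) g)) (fromℤ-*ₗ-+ n (deg L) w) ⟨
    ((fromℤ n *ₗ φ x) ∣ g +ᴹ extend φ L ∣ g) +ᴹ fromℤ (n ℤ.+ deg L) *ₗ w
      ≈⟨ +ᴹ-congʳ (∣-+ _ _ g) ⟨
    (fromℤ n *ₗ φ x +ᴹ extend φ L) ∣ g +ᴹ fromℤ (n ℤ.+ deg L) *ₗ w ∎
    where g = γ ⁻¹

  -- The defects w γ cancel on divisors of degree zero.
  extendHom : (φ : Sym → Carrierᴹ) (w : GL2+ → Carrierᴹ) →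
              (∀ γ x → φ (γ ·ₛ x) ≈ᴹ φ x ∣ (γ ⁻¹) +ᴹ w γ) → HomG V
  extendHom φ w φ-γ = record
    { ψ = λ D → extend φ (div D)
    ; ψ-resp = λ D E → extend-≋ φ (div D) (div E)
    ; ψ-hom = λ D E → extend-++ φ (div D) (div E)
    ; ψ-G = equivariant }
    where
    equivariant : ∀ γ D → extend φ (div (γ ·Ξ D)) ≈ᴹ extend φ (div D) ∣ (γ ⁻¹)
    equivariant γ (⟨ L ⟩ deg≡0) = begin
      extend φ (translate γ L)                              ≈⟨ extend-translate φ γ (w γ) (φ-γ γ) L ⟩
      extend φ L ∣ (γ ⁻¹) +ᴹ fromℤ (deg L) *ₗ w γ           ≡⟨ cong (λ k → extend φ L ∣ (γ ⁻¹) +ᴹ fromℤ k *ₗ w γ) (recompute (deg L ℤ.≟ 0ℤ) deg≡0) ⟩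
      extend φ L ∣ (γ ⁻¹) +ᴹ fromℤ 0ℤ *ₗ w γ                ≈⟨ +ᴹ-congˡ (*ₗ-zeroˡ (w γ)) ⟩
      extend φ L ∣ (γ ⁻¹) +ᴹ 0ᴹ                            ≈⟨ +ᴹ-identityʳ _ ⟩
      extend φ L ∣ (γ ⁻¹) ∎

-- * G-homomorphisms Ξ₀ → V

module Homomorphism {m ℓ : Level} {V : RightRep m ℓ} (Ψ : HomG V) where
  open RightRep V
  open HomG Ψ
  open SetoidReasoning ≈ᴹ-setoid
  module +ᴹ = AbelianGroupProperties +ᴹ-abelianGroup

  ψ-null : ∀ D → (∀ y → coeff (div D) y ≡ 0ℤ) → ψ D ≈ᴹ 0ᴹ
  ψ-null D D≋0 = ≈ᴹ-trans (ψ-resp D 0Ξ D≋0) (+ᴹ.identityˡ-unique _ _ (≈ᴹ-sym (ψ-hom 0Ξ 0Ξ)))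
    where
    0Ξ : Ξ₀
    0Ξ = ⟨ [] ⟩ refl

  ψ-[a,a] : ∀ a → ψ [ a , a ] ≈ᴹ 0ᴹ
  ψ-[a,a] a = ψ-null [ a , a ] (coeff-[a,a] a)

  ψ-chasles : ∀ a b c → ψ [ a , c ] ≈ᴹ ψ [ a , b ] +ᴹ ψ [ b , c ]
  ψ-chasles a b c = ≈ᴹ-trans (ψ-resp _ _ ([,]-chasles a b c)) (ψ-hom _ _)

  module _ (a : Sym) (ψ[a,-]≈0 : ∀ x → ψ [ a , x ] ≈ᴹ 0ᴹ) where

    ψ-0·[,] : ∀ x → ψ (0ℤ ·[ a , x ]) ≈ᴹ 0ᴹ
    ψ-0·[,] x = ψ-null (0ℤ ·[ a , x ]) (λ y →
      trans (coeff-·[,] 0ℤ a x y) (cong₂ (λ u v → u ℤ.+ (v ℤ.+ 0ℤ)) (δ-0 (x ≟ₛ y)) (δ-0 (a ≟ₛ y))))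

    ψ-+·[,] : ∀ k x → ψ ((+ k) ·[ a , x ]) ≈ᴹ 0ᴹ
    ψ-+·[,] zero x = ψ-0·[,] x
    ψ-+·[,] (suc k) x = begin
      ψ ((+ 1 ℤ.+ + k) ·[ a , x ])                  ≈⟨ ψ-resp _ _ (·[,]-+ (+ 1) (+ k) a x) ⟩
      ψ ((+ 1) ·[ a , x ] ⊕ (+ k) ·[ a , x ])       ≈⟨ ψ-hom _ _ ⟩
      ψ [ a , x ] +ᴹ ψ ((+ k) ·[ a , x ])           ≈⟨ +ᴹ-cong (ψ[a,-]≈0 x) (ψ-+·[,] k x) ⟩
      0ᴹ +ᴹ 0ᴹ                                      ≈⟨ +ᴹ-identityˡ 0ᴹ ⟩
      0ᴹ ∎

    ψ-·[,] : ∀ n x → ψ (n ·[ a , x ]) ≈ᴹ 0ᴹ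
    ψ-·[,] (+ k) x = ψ-+·[,] k x
    ψ-·[,] -[1+ k ] x = +ᴹ.identityʳ-unique _ _ (begin
      ψ ((+ suc k) ·[ a , x ]) +ᴹ ψ (-[1+ k ] ·[ a , x ])    ≈⟨ ψ-hom _ _ ⟨
      ψ ((+ suc k) ·[ a , x ] ⊕ -[1+ k ] ·[ a , x ])         ≈⟨ ψ-resp _ _ (·[,]-+ (+ suc k) -[1+ k ] a x) ⟨
      ψ ((+ suc k ℤ.+ -[1+ k ]) ·[ a , x ])                  ≡⟨ cong (λ n → ψ (n ·[ a , x ])) (ℤ.+-inverseʳ (+ suc k)) ⟩
      ψ (0ℤ ·[ a , x ])                                      ≈⟨ ψ-0·[,] x ⟩
      0ᴹ                                                     ≈⟨ ψ-+·[,] (suc k) x ⟨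
      ψ ((+ suc k) ·[ a , x ]) ∎)

    ψ-recentre : ∀ L → ψ (⟨ recentre a L ⟩ (deg-recentre a L)) ≈ᴹ 0ᴹ
    ψ-recentre [] = ψ-null (⟨ [] ⟩ refl) (λ _ → refl)
    ψ-recentre ((n , x) ∷ L) = begin
      ψ (n ·[ a , x ] ⊕ ⟨ recentre a L ⟩ (deg-recentre a L))        ≈⟨ ψ-hom _ _ ⟩
      ψ (n ·[ a , x ]) +ᴹ ψ (⟨ recentre a L ⟩ (deg-recentre a L))   ≈⟨ +ᴹ-cong (ψ-·[,] n x) (ψ-recentre L) ⟩
      0ᴹ +ᴹ 0ᴹ                                                     ≈⟨ +ᴹ-identityˡ 0ᴹ ⟩
      0ᴹ ∎

    -- Ξ₀ is generated by the divisors [a , x].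
    ψ-vanishes : ∀ D → ψ D ≈ᴹ 0ᴹ
    ψ-vanishes D = ≈ᴹ-trans (ψ-resp _ _ (recentre-≋ a D)) (ψ-recentre (div D))

-- * Cocycles

module Cocycles {m ℓ : Level} (V : RightRep m ℓ) where
  open RightRep V
  open LinearExtension V
  open SetoidReasoning ≈ᴹ-setoid
  open CommutativeSemigroupProperties (AbelianGroup.commutativeSemigroup +ᴹ-abelianGroup)
    using (interchange)

  -ᴹ-∣ : ∀ v γ → (-ᴹ v) ∣ γ ≈ᴹ -ᴹ (v ∣ γ)
  -ᴹ-∣ v γ = +ᴹ.inverseʳ-unique (v ∣ γ) ((-ᴹ v) ∣ γ) (begin
    v ∣ γ +ᴹ (-ᴹ v) ∣ γ   ≈⟨ ∣-+ v (-ᴹ v) γ ⟨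
    (v +ᴹ -ᴹ v) ∣ γ       ≈⟨ ∣-cong γ (-ᴹ‿inverseʳ v) ⟩
    0ᴹ ∣ γ                ≈⟨ 0ᴹ-∣ γ ⟩
    0ᴹ ∎)

  ∣-difference : ∀ u v γ → (u +ᴹ -ᴹ v) ∣ γ ≈ᴹ u ∣ γ +ᴹ -ᴹ (v ∣ γ)
  ∣-difference u v γ = ≈ᴹ-trans (∣-+ u (-ᴹ v) γ) (+ᴹ-congˡ (-ᴹ-∣ v γ))

  -ᴹ-coboundary : ∀ v γ → -ᴹ (v ∣[ γ -1]) ≈ᴹ (-ᴹ v) ∣[ γ -1]
  -ᴹ-coboundary v γ = begin
    -ᴹ (v ∣ γ +ᴹ -ᴹ v)        ≈⟨ +ᴹ.⁻¹-∙-comm (v ∣ γ) (-ᴹ v) ⟨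
    -ᴹ (v ∣ γ) +ᴹ -ᴹ (-ᴹ v)   ≈⟨ +ᴹ-congʳ (-ᴹ-∣ v γ) ⟨
    (-ᴹ v) ∣ γ +ᴹ -ᴹ (-ᴹ v) ∎

  coboundary-isCocycle : ∀ v → IsCocycle V (λ γ → v ∣[ γ -1])
  coboundary-isCocycle v γ₁ γ₂ = begin
    v ∣ (γ₁ ∙ γ₂) +ᴹ -ᴹ v                                ≈⟨ +ᴹ-congʳ (∣-∙ v γ₁ γ₂) ⟩
    v ∣ γ₁ ∣ γ₂ +ᴹ -ᴹ v                                  ≈⟨ +ᴹ-congʳ (+ᴹ-identityʳ _) ⟨
    (v ∣ γ₁ ∣ γ₂ +ᴹ 0ᴹ) +ᴹ -ᴹ v                          ≈⟨ +ᴹ-congʳ (+ᴹ-congˡ (-ᴹ‿inverseˡ (v ∣ γ₂))) ⟨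
    (v ∣ γ₁ ∣ γ₂ +ᴹ (-ᴹ (v ∣ γ₂) +ᴹ v ∣ γ₂)) +ᴹ -ᴹ v     ≈⟨ +ᴹ-congʳ (+ᴹ-assoc _ _ _) ⟨
    ((v ∣ γ₁ ∣ γ₂ +ᴹ -ᴹ (v ∣ γ₂)) +ᴹ v ∣ γ₂) +ᴹ -ᴹ v     ≈⟨ +ᴹ-assoc _ _ _ ⟩
    (v ∣ γ₁ ∣ γ₂ +ᴹ -ᴹ (v ∣ γ₂)) +ᴹ (v ∣ γ₂ +ᴹ -ᴹ v)     ≈⟨ +ᴹ-congʳ (∣-difference (v ∣ γ₁) v γ₂) ⟨
    (v ∣ γ₁ +ᴹ -ᴹ v) ∣ γ₂ +ᴹ (v ∣ γ₂ +ᴹ -ᴹ v) ∎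

  cocycle-difference : ∀ c c' → IsCocycle V c → IsCocycle V c' → IsCocycle V (λ γ → c γ +ᴹ -ᴹ c' γ)
  cocycle-difference c c' c-co c'-co γ₁ γ₂ = begin
    c (γ₁ ∙ γ₂) +ᴹ -ᴹ c' (γ₁ ∙ γ₂)
      ≈⟨ +ᴹ-cong (c-co γ₁ γ₂) (-ᴹ‿cong (c'-co γ₁ γ₂)) ⟩
    (c γ₁ ∣ γ₂ +ᴹ c γ₂) +ᴹ -ᴹ (c' γ₁ ∣ γ₂ +ᴹ c' γ₂)
      ≈⟨ +ᴹ-congˡ (+ᴹ.⁻¹-∙-comm _ _) ⟨
    (c γ₁ ∣ γ₂ +ᴹ c γ₂) +ᴹ (-ᴹ (c' γ₁ ∣ γ₂) +ᴹ -ᴹ c' γ₂)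
      ≈⟨ interchange _ _ _ _ ⟩
    (c γ₁ ∣ γ₂ +ᴹ -ᴹ (c' γ₁ ∣ γ₂)) +ᴹ (c γ₂ +ᴹ -ᴹ c' γ₂)
      ≈⟨ +ᴹ-congʳ (∣-difference (c γ₁) (c' γ₁) γ₂) ⟨
    (c γ₁ +ᴹ -ᴹ c' γ₁) ∣ γ₂ +ᴹ (c γ₂ +ᴹ -ᴹ c' γ₂) ∎

module BasePoint {m ℓ : Level} (V : RightRep m ℓ) (Z : Sym) where
  open RightRep V
  open LinearExtension V
  open Cocycles V
  open SetoidReasoning ≈ᴹ-setoid

  U-isCocycle : ∀ Ψ → IsCocycle V (U V Z Ψ)
  U-isCocycle Ψ γ₁ γ₂ = begin
    ψ [ Z , ((γ₁ ∙ γ₂) ⁻¹) ·ₛ Z ]                     ≡⟨ cong (λ y → ψ [ Z , y ]) γ₂⁻¹γ₁⁻¹ ⟩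
    ψ [ Z , (γ₂ ⁻¹) ·ₛ (γ₁ ⁻¹) ·ₛ Z ]                 ≈⟨ ψ-chasles Z ((γ₂ ⁻¹) ·ₛ Z) _ ⟩
    ψ [ Z , (γ₂ ⁻¹) ·ₛ Z ] +ᴹ ψ ((γ₂ ⁻¹) ·Ξ [ Z , (γ₁ ⁻¹) ·ₛ Z ])
                                                      ≈⟨ +ᴹ-congˡ (ψ-G (γ₂ ⁻¹) _) ⟩
    ψ [ Z , (γ₂ ⁻¹) ·ₛ Z ] +ᴹ ψ [ Z , (γ₁ ⁻¹) ·ₛ Z ] ∣ ((γ₂ ⁻¹) ⁻¹)
                                                      ≡⟨ cong (λ g → ψ [ Z , (γ₂ ⁻¹) ·ₛ Z ] +ᴹ ψ [ Z , (γ₁ ⁻¹) ·ₛ Z ] ∣ g) (⁻¹-involutive γ₂) ⟩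
    ψ [ Z , (γ₂ ⁻¹) ·ₛ Z ] +ᴹ ψ [ Z , (γ₁ ⁻¹) ·ₛ Z ] ∣ γ₂
                                                      ≈⟨ +ᴹ-comm _ _ ⟩
    ψ [ Z , (γ₁ ⁻¹) ·ₛ Z ] ∣ γ₂ +ᴹ ψ [ Z , (γ₂ ⁻¹) ·ₛ Z ] ∎
    where
    open HomG Ψ
    open Homomorphism Ψ
    γ₂⁻¹γ₁⁻¹ : ((γ₁ ∙ γ₂) ⁻¹) ·ₛ Z ≡ (γ₂ ⁻¹) ·ₛ (γ₁ ⁻¹) ·ₛ Z
    γ₂⁻¹γ₁⁻¹ = trans (cong (_·ₛ Z) (⁻¹-anti-homo-∙ γ₁ γ₂)) (·ₛ-∙ (γ₂ ⁻¹) (γ₁ ⁻¹) Z)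

  U-vanishes-on-stabiliser : ∀ Ψ γ → γ ·ₛ Z ≡ Z → U V Z Ψ γ ≈ᴹ 0ᴹ
  U-vanishes-on-stabiliser Ψ γ γZ≡Z =
    ≈ᴹ-trans (≈ᴹ-reflexive (cong (λ y → HomG.ψ Ψ [ Z , y ]) (fixes-⁻¹ γ Z γZ≡Z))) (Homomorphism.ψ-[a,a] Ψ Z)

  U-injective : ∀ Ψ → (∀ γ → U V Z Ψ γ ≈ᴹ 0ᴹ) → ∀ D → HomG.ψ Ψ D ≈ᴹ 0ᴹ
  U-injective Ψ U≈0 = Homomorphism.ψ-vanishes Ψ Z ψ[Z,-]≈0
    where
    ψ[Z,-]≈0 : ∀ x → HomG.ψ Ψ [ Z , x ] ≈ᴹ 0ᴹ
    ψ[Z,-]≈0 x = ≈ᴹ-trans (≈ᴹ-reflexive (cong (λ y → HomG.ψ Ψ [ Z , y ]) x≡g⁻¹⁻¹Z)) (U≈0 (g ⁻¹))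
      where
      g : GL2+
      g = proj₁ (·ₛ-transitive Z x)
      x≡g⁻¹⁻¹Z : x ≡ ((g ⁻¹) ⁻¹) ·ₛ Z
      x≡g⁻¹⁻¹Z = trans (sym (proj₂ (·ₛ-transitive Z x))) (cong (_·ₛ Z) (sym (⁻¹-involutive g)))

  -- With kₓ · Z = x, the function x ↦ c(kₓ⁻¹) is well defined modulo S = Stab(Z) because c
  -- vanishes on S, and it is equivariant up to the constants c(γ⁻¹) by the cocycle relation.
  U-surjective : ∀ c → IsCocycle V c → (∀ γ → γ ·ₛ Z ≡ Z → c γ ≈ᴹ 0ᴹ) →
                 Σ (HomG V) (λ Ψ → ∀ γ → U V Z Ψ γ ≈ᴹ c γ)
  U-surjective c c-co c-S = extendHom φ (λ γ → c (γ ⁻¹)) φ-γ , U≈c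
    where
    k : Sym → GL2+
    k x = proj₁ (·ₛ-transitive Z x)

    kZ≡ : ∀ x → k x ·ₛ Z ≡ x
    kZ≡ x = proj₂ (·ₛ-transitive Z x)

    φ : Sym → Carrierᴹ
    φ x = c (k x ⁻¹)

    φ-moved : ∀ g x → g ·ₛ Z ≡ x → φ x ≈ᴹ c (g ⁻¹)
    φ-moved g x gZ≡x = begin
      c (k x ⁻¹)                          ≡⟨ cong c (sym (//-rightDividesʳ g (k x ⁻¹))) ⟩
      c ((k x ⁻¹ ∙ g) ∙ g ⁻¹)             ≈⟨ c-co _ _ ⟩
      c (k x ⁻¹ ∙ g) ∣ (g ⁻¹) +ᴹ c (g ⁻¹)  ≈⟨ +ᴹ-congʳ (≈ᴹ-trans (∣-cong (g ⁻¹) (c-S _ k⁻¹g∈S)) (0ᴹ-∣ (g ⁻¹))) ⟩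
      0ᴹ +ᴹ c (g ⁻¹)                      ≈⟨ +ᴹ-identityˡ _ ⟩
      c (g ⁻¹) ∎
      where
      k⁻¹g∈S : (k x ⁻¹ ∙ g) ·ₛ Z ≡ Z
      k⁻¹g∈S = trans (·ₛ-∙ (k x ⁻¹) g Z)
                 (trans (cong ((k x ⁻¹) ·ₛ_) (trans gZ≡x (sym (kZ≡ x)))) (⁻¹·ₛ-cancel (k x) Z))

    φ-γ : ∀ γ x → φ (γ ·ₛ x) ≈ᴹ φ x ∣ (γ ⁻¹) +ᴹ c (γ ⁻¹)
    φ-γ γ x = begin
      φ (γ ·ₛ x)                  ≈⟨ φ-moved (γ ∙ k x) (γ ·ₛ x) γkZ≡γx ⟩
      c ((γ ∙ k x) ⁻¹)            ≡⟨ cong c (⁻¹-anti-homo-∙ γ (k x)) ⟩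
      c (k x ⁻¹ ∙ γ ⁻¹)           ≈⟨ c-co _ _ ⟩
      φ x ∣ (γ ⁻¹) +ᴹ c (γ ⁻¹) ∎
      where
      γkZ≡γx : (γ ∙ k x) ·ₛ Z ≡ γ ·ₛ x
      γkZ≡γx = trans (·ₛ-∙ γ (k x) Z) (cong (γ ·ₛ_) (kZ≡ x))

    U≈c : ∀ γ → extend φ (div [ Z , (γ ⁻¹) ·ₛ Z ]) ≈ᴹ c γ
    U≈c γ = begin
      extend φ (div [ Z , (γ ⁻¹) ·ₛ Z ])  ≈⟨ extend-[,] φ Z ((γ ⁻¹) ·ₛ Z) ⟩
      φ ((γ ⁻¹) ·ₛ Z) +ᴹ -ᴹ φ Z           ≈⟨ +ᴹ-cong (φ-moved (γ ⁻¹) _ refl) (-ᴹ‿cong φZ≈0) ⟩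
      c ((γ ⁻¹) ⁻¹) +ᴹ -ᴹ 0ᴹ              ≡⟨ cong (λ g → c g +ᴹ -ᴹ 0ᴹ) (⁻¹-involutive γ) ⟩
      c γ +ᴹ -ᴹ 0ᴹ                        ≈⟨ +ᴹ-congˡ +ᴹ.ε⁻¹≈ε ⟩
      c γ +ᴹ 0ᴹ                           ≈⟨ +ᴹ-identityʳ _ ⟩
      c γ ∎
      where
      φZ≈0 : φ Z ≈ᴹ 0ᴹ
      φZ≈0 = c-S (k Z ⁻¹) (fixes-⁻¹ (k Z) Z (kZ≡ Z))

  coboundary≈0⇒fixed : ∀ v γ → v ∣[ γ -1] ≈ᴹ 0ᴹ → v ∣ γ ≈ᴹ v
  coboundary≈0⇒fixed v γ = +ᴹ.x∙y⁻¹≈ε⇒x≈y (v ∣ γ) v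

  fixed⇒coboundary≈0 : ∀ v γ → v ∣ γ ≈ᴹ v → v ∣[ γ -1] ≈ᴹ 0ᴹ
  fixed⇒coboundary≈0 v γ vγ≈v = ≈ᴹ-trans (+ᴹ-congʳ vγ≈v) (-ᴹ‿inverseʳ v)

  U-coboundary⇒image : ∀ Ψ v → (∀ γ → U V Z Ψ γ ≈ᴹ v ∣[ γ -1]) → InvS V Z v × IsImage V Z v Ψ
  U-coboundary⇒image Ψ v U≈δv = v∈V^S , U≈δv
    where
    v∈V^S : InvS V Z v
    v∈V^S γ γZ≡Z = coboundary≈0⇒fixed v γ (≈ᴹ-trans (≈ᴹ-sym (U≈δv γ)) (U-vanishes-on-stabiliser Ψ γ γZ≡Z))

  restriction-trivial⇒U-image : ∀ c → IsCocycle V c → IsCoboundaryOnStab V Z c →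
    Σ (HomG V) (λ Ψ → IsCoboundary V (λ γ → U V Z Ψ γ +ᴹ (-ᴹ c γ)))
  restriction-trivial⇒U-image c c-co (v , c≈δv-on-S) = Ψ , -ᴹ v , λ γ → begin
    U V Z Ψ γ +ᴹ -ᴹ c γ                       ≈⟨ +ᴹ-congʳ (U≈c' γ) ⟩
    (c γ +ᴹ -ᴹ (v ∣[ γ -1])) +ᴹ -ᴹ c γ        ≈⟨ +ᴹ.xyx⁻¹≈y (c γ) _ ⟩
    -ᴹ (v ∣[ γ -1])                           ≈⟨ -ᴹ-coboundary v γ ⟩
    (-ᴹ v) ∣[ γ -1] ∎
    where
    c' : GL2+ → Carrierᴹ
    c' γ = c γ +ᴹ -ᴹ (v ∣[ γ -1])
    c'-S : ∀ γ → γ ·ₛ Z ≡ Z → c' γ ≈ᴹ 0ᴹ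
    c'-S γ γZ≡Z = ≈ᴹ-trans (+ᴹ-congʳ (c≈δv-on-S γ γZ≡Z)) (-ᴹ‿inverseʳ _)
    lift : Σ (HomG V) (λ Ψ → ∀ γ → U V Z Ψ γ ≈ᴹ c' γ)
    lift = U-surjective c' (cocycle-difference c _ c-co (coboundary-isCocycle v)) c'-S
    Ψ = proj₁ lift
    U≈c' = proj₂ lift

  U-image⇒restriction-trivial : ∀ c Ψ → IsCoboundary V (λ γ → U V Z Ψ γ +ᴹ (-ᴹ c γ)) →
    IsCoboundaryOnStab V Z c
  U-image⇒restriction-trivial c Ψ (w , U-c≈δw) = -ᴹ w , λ γ γZ≡Z → begin
    c γ                       ≈⟨ +ᴹ.⁻¹-involutive (c γ) ⟨
    -ᴹ (-ᴹ c γ)               ≈⟨ -ᴹ‿cong (+ᴹ-identityˡ _) ⟨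
    -ᴹ (0ᴹ +ᴹ -ᴹ c γ)         ≈⟨ -ᴹ‿cong (+ᴹ-congʳ (U-vanishes-on-stabiliser Ψ γ γZ≡Z)) ⟨
    -ᴹ (U V Z Ψ γ +ᴹ -ᴹ c γ)  ≈⟨ -ᴹ‿cong (U-c≈δw γ) ⟩
    -ᴹ (w ∣[ γ -1])           ≈⟨ -ᴹ-coboundary w γ ⟩
    (-ᴹ w) ∣[ γ -1] ∎

proposition1p9 : ∀ {m ℓ : Level} (V : RightRep m ℓ) (Z : Sym) →
    let open RightRep V in
    (∀ v → InvG V v → InvS V Z v)
    × (∀ v → InvS V Z v → Σ (HomG V) (IsImage V Z v))
    × (∀ v → InvS V Z v → ∀ Ψ → IsImage V Z v Ψ →
         ((∀ D → HomG.ψ Ψ D ≈ᴹ 0ᴹ) ⇔ InvG V v))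
    × (∀ Ψ → IsCocycle V (U V Z Ψ))
    × (∀ Ψ → IsCoboundary V (U V Z Ψ) ⇔ Σ Carrierᴹ (λ v → InvS V Z v × IsImage V Z v Ψ))
    × (∀ c → IsCocycle V c →
         IsCoboundaryOnStab V Z c ⇔
         Σ (HomG V) (λ Ψ → IsCoboundary V (λ γ → U V Z Ψ γ +ᴹ (-ᴹ c γ))))
proposition1p9 V Z =
    (λ v v∈V^G γ _ → v∈V^G γ)
  , (λ v v∈V^S → U-surjective (λ γ → v ∣[ γ -1]) (coboundary-isCocycle v)
                   (λ γ γZ≡Z → fixed⇒coboundary≈0 v γ (v∈V^S γ γZ≡Z)))
  , (λ v _ Ψ image → mk⇔
       (λ ψ≈0 γ → coboundary≈0⇒fixed v γ (≈ᴹ-trans (≈ᴹ-sym (image γ)) (ψ≈0 _)))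
       (λ v∈V^G → U-injective Ψ (λ γ → ≈ᴹ-trans (image γ) (fixed⇒coboundary≈0 v γ (v∈V^G γ)))))
  , U-isCocycle
  , (λ Ψ → mk⇔ (λ (v , U≈δv) → v , U-coboundary⇒image Ψ v U≈δv) (λ (v , _ , image) → v , image))
  , (λ c c-co → mk⇔ (restriction-trivial⇒U-image c c-co) (λ (Ψ , U-c) → U-image⇒restriction-trivial c Ψ U-c))
  where
  open RightRep V
  open Cocycles V using (coboundary-isCocycle)
  open BasePoint V Z
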